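{- Let $n \geq 1$ be an integer and let $K_n$ be the $(n+1)\times(n+1)$ matrix with rows and columns indexed by $m, r \in \{0,1,\dots,n\}$, whose $(m,r)$ entry is $$K_n(m,r) = \left( \sum_{i=0}^{r} (-1)^i \binom{m}{i}\binom{n-m}{r-i} \right)^2 .$$ Define $c_r = \binom{n}{r}^{ -1}$ for $0 \le r \le n$. Then for every $0 \le m \le n$, $$\sum_{r=0}^{n} K_n(m,r)\, c_r = 2^n c_m ,$$ i.e. $(c_0,\dots,c_n)$ is an eigenvector of $K_n$ with eigenvalue $2^n$.
   Context: Binomial coefficients $\binom{a}{b}$ with integers $a \ge 0$ are taken to be $0$ when $b<0$ or $b>a$. -}

module Defs where

open import Data.Nat as ℕ using (ℕ; zero; suc; _∸_)
open import Data.Nat.Combinatorics using (_C_)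
open import Data.Integer as ℤ using (ℤ)
open import Data.Rational as ℚ using (ℚ; 0ℚ)

sumℤ : ℕ → (ℕ → ℤ) → ℤ
sumℤ zero    f = f zero
sumℤ (suc n) f = sumℤ n f ℤ.+ f (suc n)

sumℚ : ℕ → (ℕ → ℚ) → ℚ
sumℚ zero    f = f zero
sumℚ (suc n) f = sumℚ n f ℚ.+ f (suc n)

sign : ℕ → ℤ
sign zero    = ℤ.+ 1
sign (suc i) = ℤ.- sign i

-- Krawtchouk-type sum  Σ_{i=0}^{r} (-1)^i C(m,i) C(n-m, r-i)
-- (here 0 ≤ i ≤ r so r ∸ i = r - i; stdlib's _C_ is 0 when k > top)
kraw : ℕ → ℕ → ℕ → ℤ
kraw n m r = sumℤ r (λ i → sign i ℤ.* ℤ.+ ((m C i) ℕ.* ((n ∸ m) C (r ∸ i))))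

K : ℕ → ℕ → ℕ → ℚ
K n m r = (kraw n m r ℤ.* kraw n m r) ℚ./ 1

-- c_r = 1 / C(n,r), for 0 ≤ r ≤ n (denominator C(n,r) nonzero there)
-- For r > n this is never used; we send 1/0 to 0 to keep c total.
invℕ : ℕ → ℚ
invℕ zero    = 0ℚ
invℕ (suc k) = ℤ.+ 1 ℚ./ suc k

c : ℕ → ℕ → ℚ
c n r = invℕ (n C r)

-- Let Kᵣ(x) be the coefficient of tʳ in (1 − t)ˣ (1 + t)ⁿ⁻ˣ, so that K n m r = Kᵣ(m)².
-- Two classical facts about these Krawtchouk polynomials suffice:
--   symmetry       C(n,m) Kᵣ(m) = C(n,r) Kₘ(r),
--   orthogonality  Σₓ C(n,x) Kᵣ(x)² = 2ⁿ C(n,r).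
-- Both follow by induction on n from the Pascal-type recurrences obtained by
-- multiplying the generating function by (1 + t) or (1 − t).  Symmetry rewrites
-- Kᵣ(m)² / C(n,r) as C(n,r) Kₘ(r)² / C(n,m)², and orthogonality sums these
-- terms to 2ⁿ C(n,m) / C(n,m)² = 2ⁿ / C(n,m).
module Submission where

open import Defs

module Krawtchouk where

  open import Data.Nat as ℕ using (ℕ; zero; suc; _∸_; _≤_; _<_; z≤n; s≤s; _^_)
  import Data.Nat.Properties as ℕP
  open import Data.Nat.Combinatorics using (_C_; nCk+nC[k+1]≡[n+1]C[k+1]; k>n⇒nCk≡0)
  open import Data.Integer as ℤ using (ℤ; +_; 0ℤ; _+_; _*_; -_; _-_)
  import Data.Integer.Properties as ℤP
  open import Data.Integer.Solver using (module +-*-Solver)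
  open import Relation.Binary.PropositionalEquality
  open import Relation.Nullary using (yes; no)
  open ≡-Reasoning
  open +-*-Solver using (solve; _:+_; _:*_; _:-_; :-_; _:=_; con)

  sumℤ-cong : ∀ n {f g : ℕ → ℤ} → (∀ i → i ≤ n → f i ≡ g i) → sumℤ n f ≡ sumℤ n g
  sumℤ-cong zero    f≗g = f≗g 0 z≤n
  sumℤ-cong (suc n) f≗g =
    cong₂ _+_ (sumℤ-cong n (λ i i≤n → f≗g i (ℕP.m≤n⇒m≤1+n i≤n))) (f≗g (suc n) ℕP.≤-refl)

  sumℤ-distrib-+ : ∀ n (f g : ℕ → ℤ) → sumℤ n (λ i → f i + g i) ≡ sumℤ n f + sumℤ n g
  sumℤ-distrib-+ zero    f g = refl
  sumℤ-distrib-+ (suc n) f g = begin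
    sumℤ n (λ i → f i + g i) + (f (suc n) + g (suc n))
      ≡⟨ cong (_+ (f (suc n) + g (suc n))) (sumℤ-distrib-+ n f g) ⟩
    (sumℤ n f + sumℤ n g) + (f (suc n) + g (suc n))
      ≡⟨ solve 4 (λ a b c d → (a :+ b) :+ (c :+ d) := (a :+ c) :+ (b :+ d)) refl
           (sumℤ n f) (sumℤ n g) (f (suc n)) (g (suc n)) ⟩
    (sumℤ n f + f (suc n)) + (sumℤ n g + g (suc n)) ∎

  sumℤ-distrib-minus : ∀ n (f g : ℕ → ℤ) → sumℤ n (λ i → f i - g i) ≡ sumℤ n f - sumℤ n g
  sumℤ-distrib-minus zero    f g = refl
  sumℤ-distrib-minus (suc n) f g = begin
    sumℤ n (λ i → f i - g i) + (f (suc n) - g (suc n))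
      ≡⟨ cong (_+ (f (suc n) - g (suc n))) (sumℤ-distrib-minus n f g) ⟩
    (sumℤ n f - sumℤ n g) + (f (suc n) - g (suc n))
      ≡⟨ solve 4 (λ a b c d → (a :- b) :+ (c :- d) := (a :+ c) :- (b :+ d)) refl
           (sumℤ n f) (sumℤ n g) (f (suc n)) (g (suc n)) ⟩
    (sumℤ n f + f (suc n)) - (sumℤ n g + g (suc n)) ∎

  sumℤ-*ˡ : ∀ n k (f : ℕ → ℤ) → sumℤ n (λ i → k * f i) ≡ k * sumℤ n f
  sumℤ-*ˡ zero    k f = refl
  sumℤ-*ˡ (suc n) k f = begin
    sumℤ n (λ i → k * f i) + k * f (suc n) ≡⟨ cong (_+ k * f (suc n)) (sumℤ-*ˡ n k f) ⟩
    k * sumℤ n f + k * f (suc n)           ≡⟨ ℤP.*-distribˡ-+ k (sumℤ n f) (f (suc n)) ⟨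
    k * (sumℤ n f + f (suc n))             ∎

  sumℤ-zero : ∀ n → sumℤ n (λ _ → 0ℤ) ≡ 0ℤ
  sumℤ-zero zero    = refl
  sumℤ-zero (suc n) = cong (_+ 0ℤ) (sumℤ-zero n)

  sumℤ-suc : ∀ n (f : ℕ → ℤ) → sumℤ (suc n) f ≡ f 0 + sumℤ n (λ i → f (suc i))
  sumℤ-suc zero    f = refl
  sumℤ-suc (suc n) f = begin
    sumℤ (suc n) f + f (suc (suc n))
      ≡⟨ cong (_+ f (suc (suc n))) (sumℤ-suc n f) ⟩
    (f 0 + sumℤ n (λ i → f (suc i))) + f (suc (suc n))
      ≡⟨ ℤP.+-assoc (f 0) _ _ ⟩
    f 0 + sumℤ (suc n) (λ i → f (suc i)) ∎

  pascal : ∀ n k → suc n C suc k ≡ n C k ℕ.+ n C suc k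
  pascal n k = sym (nCk+nC[k+1]≡[n+1]C[k+1] n k)

  pascalℤ : ∀ n k → + (suc n C suc k) ≡ + (n C k) + + (n C suc k)
  pascalℤ n k = trans (cong +_ (pascal n k)) (ℤP.pos-+ (n C k) (n C suc k))

  k≤n⇒0<nCk : ∀ {n k} → k ≤ n → 0 < n C k
  k≤n⇒0<nCk {n}     {zero}  _         = s≤s z≤n
  k≤n⇒0<nCk {suc n} {suc k} (s≤s k≤n) =
    subst (0 <_) (sym (pascal n k)) (ℕP.<-≤-trans (k≤n⇒0<nCk k≤n) (ℕP.m≤m+n _ _))

  sumℤ-pascal : ∀ n (g : ℕ → ℤ) →
    sumℤ (suc n) (λ x → + (suc n C x) * g x)
      ≡ sumℤ n (λ x → + (n C x) * g x) + sumℤ n (λ x → + (n C x) * g (suc x))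
  sumℤ-pascal n g = begin
    sumℤ (suc n) (λ x → + (suc n C x) * g x)
      ≡⟨ sumℤ-suc n _ ⟩
    head + sumℤ n (λ x → + (suc n C suc x) * g (suc x))
      ≡⟨ cong (_+_ head) (sumℤ-cong n (λ x _ → pascal-term x)) ⟩
    head + sumℤ n (λ x → + (n C x) * g (suc x) + + (n C suc x) * g (suc x))
      ≡⟨ cong (_+_ head) (sumℤ-distrib-+ n _ _) ⟩
    head + (shifted + tail)
      ≡⟨ solve 3 (λ p q t → p :+ (q :+ t) := (p :+ t) :+ q) refl head shifted tail ⟩
    (head + tail) + shifted
      ≡⟨ cong (_+ shifted) (sumℤ-suc n (λ x → + (n C x) * g x)) ⟨
    unshifted + + (n C suc n) * g (suc n) + shifted
      ≡⟨ cong (λ t → unshifted + + t * g (suc n) + shifted) (k>n⇒nCk≡0 (ℕP.n<1+n n)) ⟩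
    unshifted + 0ℤ + shifted
      ≡⟨ cong (_+ shifted) (ℤP.+-identityʳ unshifted) ⟩
    unshifted + shifted ∎
    where
    head shifted unshifted tail : ℤ
    head      = + 1 * g 0
    shifted   = sumℤ n (λ x → + (n C x) * g (suc x))
    unshifted = sumℤ n (λ x → + (n C x) * g x)
    tail      = sumℤ n (λ x → + (n C suc x) * g (suc x))
    pascal-term : ∀ x → + (suc n C suc x) * g (suc x)
                      ≡ + (n C x) * g (suc x) + + (n C suc x) * g (suc x)
    pascal-term x = trans (cong (_* g (suc x)) (pascalℤ n x))
                          (ℤP.*-distribʳ-+ (g (suc x)) (+ (n C x)) (+ (n C suc x)))

  -- krawtchouk a b r is the coefficient of tʳ in (1 − t)ᵃ (1 + t)ᵇ; kraw n m r = krawtchouk m (n ∸ m) r.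
  krawtchouk-term : ℕ → ℕ → ℕ → ℕ → ℤ
  krawtchouk-term a b r i = sign i * + ((a C i) ℕ.* (b C (r ∸ i)))

  krawtchouk : ℕ → ℕ → ℕ → ℤ
  krawtchouk a b r = sumℤ r (krawtchouk-term a b r)

  krawtchouk-zeroˡ : ∀ b r → krawtchouk 0 b r ≡ + (b C r)
  krawtchouk-zeroˡ b zero    = refl
  krawtchouk-zeroˡ b (suc r) = begin
    sumℤ (suc r) (krawtchouk-term 0 b (suc r))
      ≡⟨ sumℤ-suc r _ ⟩
    + 1 * + (1 ℕ.* (b C suc r)) + sumℤ r (λ i → sign (suc i) * + 0)
      ≡⟨ cong₂ _+_ (trans (ℤP.*-identityˡ _) (cong +_ (ℕP.*-identityˡ _)))
                   (sumℤ-cong r (λ i _ → ℤP.*-zeroʳ (sign (suc i)))) ⟩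
    + (b C suc r) + sumℤ r (λ _ → 0ℤ)
      ≡⟨ cong (_+_ (+ (b C suc r))) (sumℤ-zero r) ⟩
    + (b C suc r) + 0ℤ
      ≡⟨ ℤP.+-identityʳ _ ⟩
    + (b C suc r) ∎

  krawtchouk-term-sucʳ : ∀ a b {r} i → i ≤ r →
    krawtchouk-term a (suc b) (suc r) i ≡ krawtchouk-term a b (suc r) i + krawtchouk-term a b r i
  krawtchouk-term-sucʳ a b {r} i i≤r = begin
    sign i * + ((a C i) ℕ.* (suc b C (suc r ∸ i)))
      ≡⟨ cong (λ t → sign i * + ((a C i) ℕ.* (suc b C t))) r+1-i ⟩
    sign i * + ((a C i) ℕ.* (suc b C suc (r ∸ i)))
      ≡⟨ cong (λ t → sign i * + ((a C i) ℕ.* t)) (pascal b (r ∸ i)) ⟩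
    sign i * + ((a C i) ℕ.* (b C (r ∸ i) ℕ.+ b C suc (r ∸ i)))
      ≡⟨ cong (λ t → sign i * t) (ℤP.pos-* (a C i) _) ⟩
    sign i * (+ (a C i) * + (b C (r ∸ i) ℕ.+ b C suc (r ∸ i)))
      ≡⟨ cong (λ t → sign i * (+ (a C i) * t)) (ℤP.pos-+ (b C (r ∸ i)) _) ⟩
    sign i * (+ (a C i) * (+ (b C (r ∸ i)) + + (b C suc (r ∸ i))))
      ≡⟨ solve 4 (λ s x y z → s :* (x :* (y :+ z)) := s :* (x :* z) :+ s :* (x :* y)) refl
           (sign i) (+ (a C i)) (+ (b C (r ∸ i))) (+ (b C suc (r ∸ i))) ⟩
    sign i * (+ (a C i) * + (b C suc (r ∸ i))) + sign i * (+ (a C i) * + (b C (r ∸ i)))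
      ≡⟨ cong₂ (λ t u → sign i * t + sign i * u) (ℤP.pos-* (a C i) _) (ℤP.pos-* (a C i) _) ⟨
    sign i * + ((a C i) ℕ.* (b C suc (r ∸ i))) + krawtchouk-term a b r i
      ≡⟨ cong (λ t → sign i * + ((a C i) ℕ.* (b C t)) + krawtchouk-term a b r i) r+1-i ⟨
    krawtchouk-term a b (suc r) i + krawtchouk-term a b r i ∎
    where
    r+1-i : suc r ∸ i ≡ suc (r ∸ i)
    r+1-i = ℕP.+-∸-assoc 1 i≤r

  krawtchouk-term-sucˡ : ∀ a b r j →
    krawtchouk-term (suc a) b (suc r) (suc j) ≡ krawtchouk-term a b (suc r) (suc j) - krawtchouk-term a b r j
  krawtchouk-term-sucˡ a b r j = begin
    - sign j * + ((suc a C suc j) ℕ.* (b C (r ∸ j)))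
      ≡⟨ cong (λ t → - sign j * t) (ℤP.pos-* (suc a C suc j) _) ⟩
    - sign j * (+ (suc a C suc j) * + (b C (r ∸ j)))
      ≡⟨ cong (λ t → - sign j * (t * + (b C (r ∸ j)))) (pascalℤ a j) ⟩
    - sign j * ((+ (a C j) + + (a C suc j)) * + (b C (r ∸ j)))
      ≡⟨ solve 4 (λ s x y z → (:- s) :* ((x :+ y) :* z) := (:- s) :* (y :* z) :- s :* (x :* z)) refl
           (sign j) (+ (a C j)) (+ (a C suc j)) (+ (b C (r ∸ j))) ⟩
    - sign j * (+ (a C suc j) * + (b C (r ∸ j))) - sign j * (+ (a C j) * + (b C (r ∸ j)))
      ≡⟨ cong₂ (λ t u → - sign j * t - sign j * u) (ℤP.pos-* (a C suc j) _) (ℤP.pos-* (a C j) _) ⟨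
    krawtchouk-term a b (suc r) (suc j) - krawtchouk-term a b r j ∎

  krawtchouk-sucʳ : ∀ a b r →
    krawtchouk a (suc b) (suc r) ≡ krawtchouk a b (suc r) + krawtchouk a b r
  krawtchouk-sucʳ a b r = begin
    sumℤ r (krawtchouk-term a (suc b) (suc r)) + krawtchouk-term a (suc b) (suc r) (suc r)
      ≡⟨ cong₂ _+_ (sumℤ-cong r (krawtchouk-term-sucʳ a b)) last-term ⟩
    sumℤ r (λ i → krawtchouk-term a b (suc r) i + krawtchouk-term a b r i) + last
      ≡⟨ cong (_+ last) (sumℤ-distrib-+ r _ _) ⟩
    (sumℤ r (krawtchouk-term a b (suc r)) + krawtchouk a b r) + last
      ≡⟨ solve 3 (λ p q t → (p :+ q) :+ t := (p :+ t) :+ q) refl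
           (sumℤ r (krawtchouk-term a b (suc r))) (krawtchouk a b r) last ⟩
    krawtchouk a b (suc r) + krawtchouk a b r ∎
    where
    last : ℤ
    last = krawtchouk-term a b (suc r) (suc r)
    last-term : krawtchouk-term a (suc b) (suc r) (suc r) ≡ last
    last-term rewrite ℕP.n∸n≡0 r = refl

  krawtchouk-sucˡ : ∀ a b r →
    krawtchouk (suc a) b (suc r) ≡ krawtchouk a b (suc r) - krawtchouk a b r
  krawtchouk-sucˡ a b r = begin
    sumℤ (suc r) (krawtchouk-term (suc a) b (suc r))
      ≡⟨ sumℤ-suc r _ ⟩
    first + sumℤ r (λ j → krawtchouk-term (suc a) b (suc r) (suc j))
      ≡⟨ cong (_+_ first) (sumℤ-cong r (λ j _ → krawtchouk-term-sucˡ a b r j)) ⟩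
    first + sumℤ r (λ j → krawtchouk-term a b (suc r) (suc j) - krawtchouk-term a b r j)
      ≡⟨ cong (_+_ first) (sumℤ-distrib-minus r _ _) ⟩
    first + (sumℤ r (λ j → krawtchouk-term a b (suc r) (suc j)) - krawtchouk a b r)
      ≡⟨ ℤP.+-assoc first _ _ ⟨
    (first + sumℤ r (λ j → krawtchouk-term a b (suc r) (suc j))) - krawtchouk a b r
      ≡⟨ cong (_- krawtchouk a b r) (sumℤ-suc r _) ⟨
    krawtchouk a b (suc r) - krawtchouk a b r ∎
    where
    first : ℤ
    first = krawtchouk-term a b (suc r) 0

  sumℤ-parallelogram : ∀ n (w a b : ℕ → ℤ) →
    sumℤ n (λ x → w x * ((a x + b x) * (a x + b x))) + sumℤ n (λ x → w x * ((a x - b x) * (a x - b x)))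
      ≡ + 2 * sumℤ n (λ x → w x * (a x * a x)) + + 2 * sumℤ n (λ x → w x * (b x * b x))
  sumℤ-parallelogram n w a b = begin
    sumℤ n (λ x → w x * ((a x + b x) * (a x + b x))) + sumℤ n (λ x → w x * ((a x - b x) * (a x - b x)))
      ≡⟨ sumℤ-distrib-+ n _ _ ⟨
    sumℤ n (λ x → w x * ((a x + b x) * (a x + b x)) + w x * ((a x - b x) * (a x - b x)))
      ≡⟨ sumℤ-cong n (λ x _ → parallelogram (w x) (a x) (b x)) ⟩
    sumℤ n (λ x → + 2 * (w x * (a x * a x)) + + 2 * (w x * (b x * b x)))
      ≡⟨ sumℤ-distrib-+ n _ _ ⟩
    sumℤ n (λ x → + 2 * (w x * (a x * a x))) + sumℤ n (λ x → + 2 * (w x * (b x * b x)))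
      ≡⟨ cong₂ _+_ (sumℤ-*ˡ n (+ 2) _) (sumℤ-*ˡ n (+ 2) _) ⟩
    + 2 * sumℤ n (λ x → w x * (a x * a x)) + + 2 * sumℤ n (λ x → w x * (b x * b x)) ∎
    where
    parallelogram : ∀ c p q → c * ((p + q) * (p + q)) + c * ((p - q) * (p - q))
                              ≡ + 2 * (c * (p * p)) + + 2 * (c * (q * q))
    parallelogram = solve 3 (λ c p q → c :* ((p :+ q) :* (p :+ q)) :+ c :* ((p :- q) :* (p :- q))
                                      := con (+ 2) :* (c :* (p :* p)) :+ con (+ 2) :* (c :* (q :* q))) refl

  krawtchoukNorm² : ℕ → ℕ → ℤ
  krawtchoukNorm² n r = sumℤ n (λ x → + (n C x) * (kraw n x r * kraw n x r))

  krawtchouk-orthogonality : ∀ n r → krawtchoukNorm² n r ≡ + (2 ^ n) * + (n C r)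
  krawtchouk-orthogonality zero    zero    = refl
  krawtchouk-orthogonality zero    (suc r) rewrite krawtchouk-zeroˡ 0 (suc r) = refl
  krawtchouk-orthogonality (suc n) zero    = begin
    krawtchoukNorm² (suc n) 0
      ≡⟨ sumℤ-pascal n _ ⟩
    krawtchoukNorm² n 0 + krawtchoukNorm² n 0
      ≡⟨ cong₂ _+_ (krawtchouk-orthogonality n 0) (krawtchouk-orthogonality n 0) ⟩
    + (2 ^ n) * + 1 + + (2 ^ n) * + 1
      ≡⟨ solve 1 (λ p → p :* con (+ 1) :+ p :* con (+ 1) := (con (+ 2) :* p) :* con (+ 1)) refl (+ (2 ^ n)) ⟩
    + 2 * + (2 ^ n) * + 1
      ≡⟨ cong (_* + 1) (ℤP.pos-* 2 (2 ^ n)) ⟨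
    + (2 ^ suc n) * + (suc n C 0) ∎
  krawtchouk-orthogonality (suc n) (suc r) = begin
    krawtchoukNorm² (suc n) (suc r)
      ≡⟨ sumℤ-pascal n (λ x → kraw (suc n) x (suc r) * kraw (suc n) x (suc r)) ⟩
    sumℤ n (λ x → + (n C x) * (kraw (suc n) x (suc r) * kraw (suc n) x (suc r)))
      + sumℤ n (λ x → + (n C x) * (kraw (suc n) (suc x) (suc r) * kraw (suc n) (suc x) (suc r)))
      ≡⟨ cong₂ _+_ (sumℤ-cong n (λ x x≤n → weighted-square x (kraw-sucʳ x≤n)))
                   (sumℤ-cong n (λ x _ → weighted-square x (krawtchouk-sucˡ x (n ∸ x) r))) ⟩
    sumℤ n (λ x → + (n C x) * ((A x + B x) * (A x + B x)))
      + sumℤ n (λ x → + (n C x) * ((A x - B x) * (A x - B x)))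
      ≡⟨ sumℤ-parallelogram n (λ x → + (n C x)) A B ⟩
    + 2 * krawtchoukNorm² n (suc r) + + 2 * krawtchoukNorm² n r
      ≡⟨ cong₂ (λ u v → + 2 * u + + 2 * v)
               (krawtchouk-orthogonality n (suc r)) (krawtchouk-orthogonality n r) ⟩
    + 2 * (+ (2 ^ n) * + (n C suc r)) + + 2 * (+ (2 ^ n) * + (n C r))
      ≡⟨ solve 3 (λ p u v → con (+ 2) :* (p :* v) :+ con (+ 2) :* (p :* u) := (con (+ 2) :* p) :* (u :+ v)) refl
           (+ (2 ^ n)) (+ (n C r)) (+ (n C suc r)) ⟩
    + 2 * + (2 ^ n) * (+ (n C r) + + (n C suc r))
      ≡⟨ cong₂ _*_ (ℤP.pos-* 2 (2 ^ n)) (pascalℤ n r) ⟨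
    + (2 ^ suc n) * + (suc n C suc r) ∎
    where
    A B : ℕ → ℤ
    A x = kraw n x (suc r)
    B x = kraw n x r
    weighted-square : ∀ x {p q} → p ≡ q → + (n C x) * (p * p) ≡ + (n C x) * (q * q)
    weighted-square x = cong (λ t → + (n C x) * (t * t))
    kraw-sucʳ : ∀ {x} → x ≤ n → kraw (suc n) x (suc r) ≡ A x + B x
    kraw-sucʳ {x} x≤n rewrite ℕP.+-∸-assoc 1 x≤n = krawtchouk-sucʳ x (n ∸ x) r

  binomialKraw : ℕ → ℕ → ℕ → ℤ
  binomialKraw n m r = + (n C m) * kraw n m r

  binomialKraw-zeroʳ : ∀ n m → binomialKraw n m 0 ≡ + (n C m)
  binomialKraw-zeroʳ n m = ℤP.*-identityʳ (+ (n C m))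

  binomialKraw-zeroˡ : ∀ n r → binomialKraw n 0 r ≡ + (n C r)
  binomialKraw-zeroˡ n r = trans (ℤP.*-identityˡ _) (krawtchouk-zeroˡ n r)

  binomialKraw-suc : ∀ n m r →
    binomialKraw (suc n) (suc m) (suc r)
      ≡ binomialKraw n (suc m) (suc r) + binomialKraw n (suc m) r + binomialKraw n m (suc r) - binomialKraw n m r
  binomialKraw-suc n m r = begin
    + (suc n C suc m) * q
      ≡⟨ cong (_* q) (pascalℤ n m) ⟩
    (+ (n C m) + + (n C suc m)) * q
      ≡⟨ ℤP.*-distribʳ-+ q (+ (n C m)) (+ (n C suc m)) ⟩
    + (n C m) * q + + (n C suc m) * q
      ≡⟨ cong₂ _+_ (cong (+ (n C m) *_) (krawtchouk-sucˡ m (n ∸ m) r)) upper ⟩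
    + (n C m) * (kraw n m (suc r) - kraw n m r) + (binomialKraw n (suc m) (suc r) + binomialKraw n (suc m) r)
      ≡⟨ solve 5 (λ c a b x y → c :* (a :- b) :+ (x :+ y) := x :+ y :+ c :* a :- c :* b) refl
           (+ (n C m)) (kraw n m (suc r)) (kraw n m r) (binomialKraw n (suc m) (suc r)) (binomialKraw n (suc m) r) ⟩
    binomialKraw n (suc m) (suc r) + binomialKraw n (suc m) r + binomialKraw n m (suc r) - binomialKraw n m r ∎
    where
    q : ℤ
    q = krawtchouk (suc m) (n ∸ m) (suc r)
    upper : + (n C suc m) * q ≡ binomialKraw n (suc m) (suc r) + binomialKraw n (suc m) r
    upper with suc m ℕ.≤? n
    ... | no m≮n rewrite k>n⇒nCk≡0 (ℕP.≰⇒> m≮n) = refl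
    ... | yes m<n = begin
      + (n C suc m) * q
        ≡⟨ cong (λ t → + (n C suc m) * krawtchouk (suc m) t (suc r)) (ℕP.+-∸-assoc 1 m<n) ⟩
      + (n C suc m) * krawtchouk (suc m) (suc (n ∸ suc m)) (suc r)
        ≡⟨ cong (+ (n C suc m) *_) (krawtchouk-sucʳ (suc m) (n ∸ suc m) r) ⟩
      + (n C suc m) * (kraw n (suc m) (suc r) + kraw n (suc m) r)
        ≡⟨ ℤP.*-distribˡ-+ (+ (n C suc m)) (kraw n (suc m) (suc r)) (kraw n (suc m) r) ⟩
      binomialKraw n (suc m) (suc r) + binomialKraw n (suc m) r ∎

  binomialKraw-symmetric : ∀ n m r → binomialKraw n m r ≡ binomialKraw n r m
  binomialKraw-symmetric n       m       zero    =
    trans (binomialKraw-zeroʳ n m) (sym (binomialKraw-zeroˡ n m))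
  binomialKraw-symmetric n       zero    (suc r) =
    trans (binomialKraw-zeroˡ n (suc r)) (sym (binomialKraw-zeroʳ n (suc r)))
  binomialKraw-symmetric zero    (suc m) (suc r) = refl
  binomialKraw-symmetric (suc n) (suc m) (suc r) = begin
    binomialKraw (suc n) (suc m) (suc r)
      ≡⟨ binomialKraw-suc n m r ⟩
    S (suc m) (suc r) + S (suc m) r + S m (suc r) - S m r
      ≡⟨ cong₂ _-_ (cong₂ _+_ (cong₂ _+_ (IH (suc m) (suc r)) (IH (suc m) r)) (IH m (suc r))) (IH m r) ⟩
    S (suc r) (suc m) + S r (suc m) + S (suc r) m - S r m
      ≡⟨ solve 4 (λ a b c d → a :+ b :+ c :- d := a :+ c :+ b :- d) refl
           (S (suc r) (suc m)) (S r (suc m)) (S (suc r) m) (S r m) ⟩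
    S (suc r) (suc m) + S (suc r) m + S r (suc m) - S r m
      ≡⟨ binomialKraw-suc n r m ⟨
    binomialKraw (suc n) (suc r) (suc m) ∎
    where
    S : ℕ → ℕ → ℤ
    S = binomialKraw n
    IH : ∀ m r → S m r ≡ S r m
    IH = binomialKraw-symmetric n

module Rationals where

  open import Data.Nat as ℕ using (ℕ; zero; suc; _≤_; z≤n)
  import Data.Nat.Properties as ℕP
  open import Data.Integer as ℤ using (ℤ; +_)
  open import Data.Rational using (ℚ; _/_; _+_; _*_; 1ℚ; toℚᵘ)
  import Data.Integer.Properties as ℤP
  import Data.Rational.Properties as ℚP
  open import Data.Rational.Unnormalised as ℚᵘ using (mkℚᵘ; *≡*)
  import Data.Rational.Unnormalised.Properties as ℚᵘP
  open import Data.Rational.Solver using (module +-*-Solver)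
  open import Relation.Binary.PropositionalEquality
  open +-*-Solver using (solve; _:*_; _:=_)

  fromℤ : ℤ → ℚ
  fromℤ z = z / 1

  toℚᵘ-fromℤ : ∀ z → toℚᵘ (fromℤ z) ℚᵘ.≃ mkℚᵘ z 0
  toℚᵘ-fromℤ z = ℚP.toℚᵘ-fromℚᵘ (mkℚᵘ z 0)

  fromℤ-+ : ∀ a b → fromℤ (a ℤ.+ b) ≡ fromℤ a + fromℤ b
  fromℤ-+ a b = ℚP.toℚᵘ-injective (begin
    toℚᵘ (fromℤ (a ℤ.+ b))                ≈⟨ toℚᵘ-fromℤ (a ℤ.+ b) ⟩
    mkℚᵘ (a ℤ.+ b) 0
      ≈⟨ *≡* (cong (ℤ._* + 1) (cong₂ ℤ._+_ (ℤP.*-identityʳ a) (ℤP.*-identityʳ b))) ⟨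
    mkℚᵘ a 0 ℚᵘ.+ mkℚᵘ b 0                ≈⟨ ℚᵘP.+-cong (toℚᵘ-fromℤ a) (toℚᵘ-fromℤ b) ⟨
    toℚᵘ (fromℤ a) ℚᵘ.+ toℚᵘ (fromℤ b)    ≈⟨ ℚP.toℚᵘ-homo-+ (fromℤ a) (fromℤ b) ⟨
    toℚᵘ (fromℤ a + fromℤ b)              ∎)
    where
    open ℚᵘP.≃-Reasoning

  fromℤ-* : ∀ a b → fromℤ (a ℤ.* b) ≡ fromℤ a * fromℤ b
  fromℤ-* a b = ℚP.toℚᵘ-injective (begin
    toℚᵘ (fromℤ (a ℤ.* b))                ≈⟨ toℚᵘ-fromℤ (a ℤ.* b) ⟩
    mkℚᵘ a 0 ℚᵘ.* mkℚᵘ b 0                ≈⟨ ℚᵘP.*-cong (toℚᵘ-fromℤ a) (toℚᵘ-fromℤ b) ⟨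
    toℚᵘ (fromℤ a) ℚᵘ.* toℚᵘ (fromℤ b)    ≈⟨ ℚP.toℚᵘ-homo-* (fromℤ a) (fromℤ b) ⟨
    toℚᵘ (fromℤ a * fromℤ b)              ∎)
    where open ℚᵘP.≃-Reasoning

  fromℤ-*-invℕ : ∀ n .{{_ : ℕ.NonZero n}} → fromℤ (+ n) * invℕ n ≡ 1ℚ
  fromℤ-*-invℕ (suc k) = ℚP.toℚᵘ-injective (begin
    toℚᵘ (fromℤ (+ suc k) * invℕ (suc k))
      ≈⟨ ℚP.toℚᵘ-homo-* (fromℤ (+ suc k)) (invℕ (suc k)) ⟩
    toℚᵘ (fromℤ (+ suc k)) ℚᵘ.* toℚᵘ (invℕ (suc k))
      ≈⟨ ℚᵘP.*-cong (toℚᵘ-fromℤ (+ suc k)) (ℚP.toℚᵘ-fromℚᵘ (mkℚᵘ (+ 1) k)) ⟩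
    mkℚᵘ (+ suc k) 0 ℚᵘ.* mkℚᵘ (+ 1) k
      ≈⟨ *≡* cross-product ⟩
    toℚᵘ 1ℚ ∎)
    where
    open ℚᵘP.≃-Reasoning
    cross-product : (+ suc k ℤ.* + 1) ℤ.* + 1 ≡ + 1 ℤ.* + (1 ℕ.* suc k)
    cross-product = trans (ℤP.*-identityʳ _) (trans (ℤP.*-identityʳ _)
                      (sym (trans (ℤP.*-identityˡ _) (cong +_ (ℕP.*-identityˡ (suc k))))))

  sumℚ-cong : ∀ n {f g : ℕ → ℚ} → (∀ i → i ≤ n → f i ≡ g i) → sumℚ n f ≡ sumℚ n g
  sumℚ-cong zero    f≗g = f≗g 0 z≤n
  sumℚ-cong (suc n) f≗g =
    cong₂ _+_ (sumℚ-cong n (λ i i≤n → f≗g i (ℕP.m≤n⇒m≤1+n i≤n))) (f≗g (suc n) ℕP.≤-refl)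

  sumℚ-fromℤ-*ʳ : ∀ n (f : ℕ → ℤ) q → sumℚ n (λ i → fromℤ (f i) * q) ≡ fromℤ (sumℤ n f) * q
  sumℚ-fromℤ-*ʳ zero    f q = refl
  sumℚ-fromℤ-*ʳ (suc n) f q = begin
    sumℚ n (λ i → fromℤ (f i) * q) + fromℤ (f (suc n)) * q
      ≡⟨ cong (_+ fromℤ (f (suc n)) * q) (sumℚ-fromℤ-*ʳ n f q) ⟩
    fromℤ (sumℤ n f) * q + fromℤ (f (suc n)) * q
      ≡⟨ ℚP.*-distribʳ-+ q (fromℤ (sumℤ n f)) (fromℤ (f (suc n))) ⟨
    (fromℤ (sumℤ n f) + fromℤ (f (suc n))) * q
      ≡⟨ cong (_* q) (fromℤ-+ (sumℤ n f) (f (suc n))) ⟨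
    fromℤ (sumℤ n f ℤ.+ f (suc n)) * q ∎
    where open ≡-Reasoning

  square-rescale : ∀ {a b k l α β : ℚ} → a * k ≡ b * l → a * α ≡ 1ℚ → b * β ≡ 1ℚ →
                   k * k * β ≡ b * (l * l) * (α * α)
  square-rescale {a} {b} {k} {l} {α} {β} ak≡bl aα≡1 bβ≡1 = begin
    k * k * β
      ≡⟨ cong (λ t → t * t * β) k≡blα ⟩
    (b * l * α) * (b * l * α) * β
      ≡⟨ solve 4 (λ b l α β → (b :* l :* α) :* (b :* l :* α) :* β
                             := b :* (l :* l) :* (α :* α) :* (b :* β))
           refl b l α β ⟩
    b * (l * l) * (α * α) * (b * β)
      ≡⟨ cong (b * (l * l) * (α * α) *_) bβ≡1 ⟩
    b * (l * l) * (α * α) * 1ℚ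
      ≡⟨ ℚP.*-identityʳ _ ⟩
    b * (l * l) * (α * α) ∎
    where
    open ≡-Reasoning
    k≡blα : k ≡ b * l * α
    k≡blα = begin
      k             ≡⟨ ℚP.*-identityʳ k ⟨
      k * 1ℚ        ≡⟨ cong (k *_) aα≡1 ⟨
      k * (a * α)   ≡⟨ solve 3 (λ k a α → k :* (a :* α) := a :* k :* α) refl k a α ⟩
      a * k * α     ≡⟨ cong (_* α) ak≡bl ⟩
      b * l * α     ∎

  *-inverse-square : ∀ {a α : ℚ} x → a * α ≡ 1ℚ → x * a * (α * α) ≡ x * α
  *-inverse-square {a} {α} x aα≡1 = begin
    x * a * (α * α)     ≡⟨ solve 3 (λ x a α → x :* a :* (α :* α) := x :* α :* (a :* α)) refl x a α ⟩
    x * α * (a * α)     ≡⟨ cong (x * α *_) aα≡1 ⟩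
    x * α * 1ℚ          ≡⟨ ℚP.*-identityʳ _ ⟩
    x * α               ∎
    where open ≡-Reasoning

open Krawtchouk using (k≤n⇒0<nCk; krawtchoukNorm²; krawtchouk-orthogonality; binomialKraw-symmetric)
open Rationals

open import Data.Nat as ℕ using (ℕ; _≤_; _^_)
open import Data.Nat.Combinatorics using (_C_)
open import Data.Integer as ℤ using (+_)
open import Data.Rational using (_*_; _/_; 1ℚ)
open import Relation.Binary.PropositionalEquality using (_≡_; cong; sym; trans; module ≡-Reasoning)
open ≡-Reasoning

fromℤ-C-*-c : ∀ {n k} → k ≤ n → fromℤ (+ (n C k)) * c n k ≡ 1ℚ
fromℤ-C-*-c {n} {k} k≤n = fromℤ-*-invℕ (n C k) {{ℕ.>-nonZero (k≤n⇒0<nCk k≤n)}}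

K-*-c : ∀ {n m r} → m ≤ n → r ≤ n →
  K n m r * c n r ≡ fromℤ (+ (n C r) ℤ.* (kraw n r m ℤ.* kraw n r m)) * (c n m * c n m)
K-*-c {n} {m} {r} m≤n r≤n = begin
  fromℤ (k ℤ.* k) * c n r
    ≡⟨ cong (_* c n r) (fromℤ-* k k) ⟩
  fromℤ k * fromℤ k * c n r
    ≡⟨ square-rescale {fromℤ (+ (n C m))} {fromℤ (+ (n C r))} {fromℤ k} {fromℤ l}
                      symmetry (fromℤ-C-*-c {n} {m} m≤n) (fromℤ-C-*-c {n} {r} r≤n) ⟩
  fromℤ (+ (n C r)) * (fromℤ l * fromℤ l) * (c n m * c n m)
    ≡⟨ cong (λ t → fromℤ (+ (n C r)) * t * (c n m * c n m)) (fromℤ-* l l) ⟨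
  fromℤ (+ (n C r)) * fromℤ (l ℤ.* l) * (c n m * c n m)
    ≡⟨ cong (_* (c n m * c n m)) (fromℤ-* (+ (n C r)) (l ℤ.* l)) ⟨
  fromℤ (+ (n C r) ℤ.* (l ℤ.* l)) * (c n m * c n m) ∎
  where
  k l : ℤ.ℤ
  k = kraw n m r
  l = kraw n r m
  symmetry : fromℤ (+ (n C m)) * fromℤ k ≡ fromℤ (+ (n C r)) * fromℤ l
  symmetry = trans (sym (fromℤ-* (+ (n C m)) k))
               (trans (cong fromℤ (binomialKraw-symmetric n m r)) (fromℤ-* (+ (n C r)) l))

proposition2 : (n : ℕ) → 1 ≤ n → (m : ℕ) → m ≤ n →
    sumℚ n (λ r → K n m r * c n r) ≡ ((+ (2 ^ n)) / 1) * c n m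
proposition2 n _ m m≤n = begin
  sumℚ n (λ r → K n m r * c n r)
    ≡⟨ sumℚ-cong n (λ r r≤n → K-*-c m≤n r≤n) ⟩
  sumℚ n (λ r → fromℤ (+ (n C r) ℤ.* (kraw n r m ℤ.* kraw n r m)) * (c n m * c n m))
    ≡⟨ sumℚ-fromℤ-*ʳ n _ (c n m * c n m) ⟩
  fromℤ (krawtchoukNorm² n m) * (c n m * c n m)
    ≡⟨ cong (λ t → fromℤ t * (c n m * c n m)) (krawtchouk-orthogonality n m) ⟩
  fromℤ (+ (2 ^ n) ℤ.* + (n C m)) * (c n m * c n m)
    ≡⟨ cong (_* (c n m * c n m)) (fromℤ-* (+ (2 ^ n)) (+ (n C m))) ⟩
  fromℤ (+ (2 ^ n)) * fromℤ (+ (n C m)) * (c n m * c n m)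
    ≡⟨ *-inverse-square (fromℤ (+ (2 ^ n))) (fromℤ-C-*-c {n} {m} m≤n) ⟩
  fromℤ (+ (2 ^ n)) * c n m ∎
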